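{- For every positive integer $n$ there exists a non-negative even integer $c$ such that the set $\{c, c+2, c+4, \dots, c+2(n-1)\}$ of $n$ consecutive even numbers is an independent set in $\mathcal{G}_\infty$.
   Context: Let $\mathcal{P}$ be the set of odd primes. $\mathcal{G}_\infty$ is the simple undirected graph whose vertex set is the set of non-negative even integers, in which distinct $a,b$ are adjacent iff $\frac{a+b}{2}\in\mathcal{P}$ and $\frac{|a-b|}{2}\in\mathcal{P}$. An independent set is a set of vertices no two of which are adjacent. -}

module Defs where

open import Data.Nat using (ℕ; _+_; _*_; ∣_-_∣; _<_)
open import Data.Nat.Primality using (Prime)
open import Data.Nat.Divisibility using (_∣_)
open import Data.Product using (_×_; ∃)
open import Relation.Binary.PropositionalEquality using (_≡_; _≢_)
open import Relation.Nullary using (¬_)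

OddPrime : ℕ → Set
OddPrime p = Prime p × ¬ (2 ∣ p)

IsVertex : ℕ → Set
IsVertex a = 2 ∣ a

-- adjacency in G∞ for distinct even a, b:
-- (a+b)/2 and |a-b|/2 are odd primes (halving stated as a+b = 2*p)
Adjacent : ℕ → ℕ → Set
Adjacent a b = a ≢ b
             × ∃ (λ p → a + b ≡ 2 * p × OddPrime p)
             × ∃ (λ q → ∣ a - b ∣ ≡ 2 * q × OddPrime q)

Independent : (ℕ → Set) → Set
Independent S = (∀ a → S a → IsVertex a) × (∀ a b → S a → S b → ¬ Adjacent a b)

ConsecEvens : ℕ → ℕ → ℕ → Set
ConsecEvens c n a = ∃ (λ i → i < n × a ≡ c + 2 * i)

-- Take c = (2n)!. For vertices c + 2i and c + 2j of the block, half their sum is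
-- c + (i + j); when i + j ≥ 2 this is a proper multiple of i + j ≤ 2n, since
-- i + j divides (2n)!, so it is not prime. The remaining pairs are i = j, which
-- is no edge, and {i, j} = {0, 1}, whose half-difference 1 is not prime.
module Submission where

open import Defs
open import Data.Nat using (ℕ; _>_)
open import Data.Nat.Divisibility using (_∣_)
open import Data.Product using (_×_; ∃)

open import Data.Nat.Base
  using (suc; _+_; _*_; _!; _≤_; _<_; z≤n; s≤s; ∣_-_∣; NonZero; NonTrivial; n>1⇒nonTrivial; >-nonZero)
open import Data.Nat.Properties
  using (+-mono-≤; *-cancelˡ-≡; *-distribˡ-∣-∣; ∣m+n-m+o∣≡∣n-o∣; m<n+m; <⇒≢; <⇒≤; 0<1+n; _!≢0)
open import Data.Nat.Divisibility using (∣-trans; ∣-refl; m∣m*n; ∣m∣n⇒∣m+n; m≤n⇒m!∣n!)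
open import Data.Nat.Primality using (Composite; composite-≢; composite⇒¬prime; ¬prime[1])
open import Data.Product using (_,_; proj₁)
open import Relation.Binary.PropositionalEquality using (_≡_; refl; sym; trans; subst)
open import Relation.Nullary using (¬_)
open import Data.Nat.Tactic.RingSolver using (solve-∀)

m∣n! : ∀ {m n} → .{{NonZero m}} → m ≤ n → m ∣ n !
m∣n! {suc m} m≤n = ∣-trans (m∣m*n (m !)) (m≤n⇒m!∣n! m≤n)

composite[m+k] : ∀ m k → .{{NonZero m}} → .{{NonTrivial k}} → k ∣ m → Composite (m + k)
composite[m+k] (suc m) k k∣m = composite-≢ k (<⇒≢ (m<n+m k 0<1+n)) (∣m∣n⇒∣m+n k∣m ∣-refl)

halve : ∀ {x y} → 2 * x ≡ 2 * y → x ≡ y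
halve {x} {y} = *-cancelˡ-≡ x y 2

sum-evens : ∀ c i j → (c + 2 * i) + (c + 2 * j) ≡ 2 * (c + (i + j))
sum-evens = solve-∀

∣-∣-evens : ∀ c i j → ∣ c + 2 * i - c + 2 * j ∣ ≡ 2 * ∣ i - j ∣
∣-∣-evens c i j = trans (∣m+n-m+o∣≡∣n-o∣ c (2 * i) (2 * j)) (sym (*-distribˡ-∣-∣ 2 i j))

module _ {c i j : ℕ} where

  adjacent⇒oddPrime-halfSum : Adjacent (c + 2 * i) (c + 2 * j) → OddPrime (c + (i + j))
  adjacent⇒oddPrime-halfSum (_ , (p , sum≡2p , p-oddPrime) , _) =
    subst OddPrime (halve (trans (sym sum≡2p) (sum-evens c i j))) p-oddPrime

  adjacent⇒oddPrime-halfDiff : Adjacent (c + 2 * i) (c + 2 * j) → OddPrime ∣ i - j ∣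
  adjacent⇒oddPrime-halfDiff (_ , _ , (q , diff≡2q , q-oddPrime)) =
    subst OddPrime (halve (trans (sym diff≡2q) (∣-∣-evens c i j))) q-oddPrime

module _ {c n : ℕ} .{{_ : NonZero c}} (divisible : ∀ {k} → .{{NonZero k}} → k ≤ n + n → k ∣ c) where

  ¬adjacent-of-halfSum>1 : ∀ {i j} → 1 < i + j → i < n → j < n → ¬ Adjacent (c + 2 * i) (c + 2 * j)
  ¬adjacent-of-halfSum>1 {i} {j} 1<i+j i<n j<n adj =
    composite⇒¬prime (composite[m+k] c (i + j) i+j∣c) (proj₁ (adjacent⇒oddPrime-halfSum {c} {i} {j} adj))
    where
    instance
      _ = n>1⇒nonTrivial 1<i+j
      _ = >-nonZero (<⇒≤ 1<i+j)
    i+j∣c : i + j ∣ c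
    i+j∣c = divisible (+-mono-≤ (<⇒≤ i<n) (<⇒≤ j<n))

  consecEvens-¬adjacent : ∀ {i j} → i < n → j < n → ¬ Adjacent (c + 2 * i) (c + 2 * j)
  consecEvens-¬adjacent {0} {0} _ _ adj = proj₁ adj refl
  consecEvens-¬adjacent {1} {1} _ _ adj = proj₁ adj refl
  consecEvens-¬adjacent {0} {1} _ _ adj = ¬prime[1] (proj₁ (adjacent⇒oddPrime-halfDiff {c} {0} {1} adj))
  consecEvens-¬adjacent {1} {0} _ _ adj = ¬prime[1] (proj₁ (adjacent⇒oddPrime-halfDiff {c} {1} {0} adj))
  consecEvens-¬adjacent {0} {suc (suc _)} = ¬adjacent-of-halfSum>1 (s≤s (s≤s z≤n))
  consecEvens-¬adjacent {1} {suc (suc _)} = ¬adjacent-of-halfSum>1 (s≤s (s≤s z≤n))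
  consecEvens-¬adjacent {suc (suc _)} {_} = ¬adjacent-of-halfSum>1 (s≤s (s≤s z≤n))

  consecEvens-independent : 2 ∣ c → Independent (ConsecEvens c n)
  consecEvens-independent 2∣c =
    (λ { _ (i , _ , refl) → ∣m∣n⇒∣m+n 2∣c (m∣m*n i) }) ,
    (λ { _ _ (_ , i<n , refl) (_ , j<n , refl) → consecEvens-¬adjacent i<n j<n })

mainTheorem15 : ∀ (n : ℕ) → n > 0 → ∃ (λ c → 2 ∣ c × Independent (ConsecEvens c n))
mainTheorem15 n n>0 = (n + n) ! , 2∣c , consecEvens-independent m∣n! 2∣c
  where
  instance
    _ = (n + n) !≢0
  2∣c : 2 ∣ (n + n) !
  2∣c = m∣n! (+-mono-≤ n>0 n>0)
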